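{- Let $A$ be a pseudo BCK-algebra and $\mu$ a normal type II state operator on $A$. Then: (1) the map $\hat\mu:A/{\rm Ker}(\mu)\to A/{\rm Ker}(\mu)$, $\hat\mu(x/{\rm Ker}(\mu))=\mu(x)/{\rm Ker}(\mu)$, is well defined and is both a normal type I and a normal type II state operator on $A/{\rm Ker}(\mu)$; (2) $\mu$ is a normal type I state operator on $A$.
   Context: A pseudo BCK-algebra is an algebra $(A,\rightarrow,\rightsquigarrow,1)$ of type $(2,2,0)$ such that for all $x,y,z\in A$: $(x\rightarrow y)\rightsquigarrow[(y\rightarrow z)\rightsquigarrow(x\rightarrow z)]=1$; $(x\rightsquigarrow y)\rightarrow[(y\rightsquigarrow z)\rightarrow(x\rightsquigarrow z)]=1$; $1\rightarrow x=x$; $1\rightsquigarrow x=x$; $x\rightarrow 1=1$; and if $x\rightarrow y=1$ and $y\rightarrow x=1$ then $x=y$. The order is $x\le y$ iff $x\rightarrow y=1$ (iff $x\rightsquigarrow y=1$). A deductive system is a subset $D$ with $1\in D$ such that $x, x\rightarrow y\in D$ imply $y\in D$; it is normal if $x\rightarrow y\in D$ iff $x\rightsquigarrow y\in D$. For a normal deductive system $H$, $\Theta_H$ given by $(x,y)\in\Theta_H$ iff $x\rightarrow y, y\rightarrow x\in H$ is a congruence, $A/H=A/\Theta_H$ with induced operations is a pseudo BCK-algebra, $x/H$ is the class of $x$. For $\mu:A\to A$ consider, for all $x,y\in A$: $(IS_1)$ $x\le y$ implies $\mu(x)\le\mu(y)$; $(IS_2)$ $\mu(x\rightarrow y)=\mu((x\rightarrow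 y)\rightsquigarrow y)\rightarrow\mu(y)$ and $\mu(x\rightsquigarrow y)=\mu((x\rightsquigarrow y)\rightarrow y)\rightsquigarrow\mu(y)$; $(IS_2')$ $\mu(x\rightarrow y)=\mu((y\rightarrow x)\rightsquigarrow x)\rightarrow\mu(y)$ and $\mu(x\rightsquigarrow y)=\mu((y\rightsquigarrow x)\rightarrow x)\rightsquigarrow\mu(y)$; $(IS_3)$ $\mu(\mu(x)\rightarrow\mu(y))=\mu(x)\rightarrow\mu(y)$ and $\mu(\mu(x)\rightsquigarrow\mu(y))=\mu(x)\rightsquigarrow\mu(y)$. A type I state operator satisfies $(IS_1),(IS_2),(IS_3)$; a type II one satisfies $(IS_1),(IS_2'),(IS_3)$. ${\rm Ker}(\mu)=\{x\in A\mid\mu(x)=1\}$; $\mu$ is normal if ${\rm Ker}(\mu)$ is a normal deductive system. -}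

module Defs where

open import Data.Product using (_×_; _,_)
open import Relation.Binary.PropositionalEquality using (_≡_)

-- A pseudo BCK-algebra (A, ⇒, ⇝, 𝟏); x ⇒ y is "x → y", x ⇝ y is "x ⇝ y".
record PseudoBCK : Set₁ where
  infixr 5 _⇒_ _⇝_
  field
    Carrier : Set
    _⇒_ : Carrier → Carrier → Carrier
    _⇝_ : Carrier → Carrier → Carrier
    𝟏   : Carrier
    ax1 : ∀ x y z → (x ⇒ y) ⇝ ((y ⇒ z) ⇝ (x ⇒ z)) ≡ 𝟏
    ax2 : ∀ x y z → (x ⇝ y) ⇒ ((y ⇝ z) ⇒ (x ⇝ z)) ≡ 𝟏
    ax3 : ∀ x → 𝟏 ⇒ x ≡ x
    ax4 : ∀ x → 𝟏 ⇝ x ≡ x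
    ax5 : ∀ x → x ⇒ 𝟏 ≡ 𝟏
    ax6 : ∀ x y → x ⇒ y ≡ 𝟏 → y ⇒ x ≡ 𝟏 → x ≡ y
    ord⇒⇝ : ∀ x y → x ⇒ y ≡ 𝟏 → x ⇝ y ≡ 𝟏
    ord⇝⇒ : ∀ x y → x ⇝ y ≡ 𝟏 → x ⇒ y ≡ 𝟏

module _ (A : PseudoBCK) where
  open PseudoBCK A

  -- All notions below are parametrised by an equality _≈_ on the carrier:
  -- _≡_ gives the notions on A itself, Θ H gives the notions on A/H
  -- (elements of A/H being represented by elements of A, and the
  -- operations of A/H being the induced ones).

  Leq : (Carrier → Carrier → Set) → Carrier → Carrier → Set
  Leq _≈_ x y = (x ⇒ y) ≈ 𝟏

  IS1 : (Carrier → Carrier → Set) → (Carrier → Carrier) → Set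
  IS1 _≈_ μ = ∀ x y → Leq _≈_ x y → Leq _≈_ (μ x) (μ y)

  IS2 : (Carrier → Carrier → Set) → (Carrier → Carrier) → Set
  IS2 _≈_ μ = ∀ x y →
      (μ (x ⇒ y) ≈ (μ ((x ⇒ y) ⇝ y) ⇒ μ y))
    × (μ (x ⇝ y) ≈ (μ ((x ⇝ y) ⇒ y) ⇝ μ y))

  IS2' : (Carrier → Carrier → Set) → (Carrier → Carrier) → Set
  IS2' _≈_ μ = ∀ x y →
      (μ (x ⇒ y) ≈ (μ ((y ⇒ x) ⇝ x) ⇒ μ y))
    × (μ (x ⇝ y) ≈ (μ ((y ⇝ x) ⇒ x) ⇝ μ y))

  IS3 : (Carrier → Carrier → Set) → (Carrier → Carrier) → Set
  IS3 _≈_ μ = ∀ x y →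
      (μ (μ x ⇒ μ y) ≈ (μ x ⇒ μ y))
    × (μ (μ x ⇝ μ y) ≈ (μ x ⇝ μ y))

  TypeI : (Carrier → Carrier → Set) → (Carrier → Carrier) → Set
  TypeI _≈_ μ = IS1 _≈_ μ × IS2 _≈_ μ × IS3 _≈_ μ

  TypeII : (Carrier → Carrier → Set) → (Carrier → Carrier) → Set
  TypeII _≈_ μ = IS1 _≈_ μ × IS2' _≈_ μ × IS3 _≈_ μ

  Ker : (Carrier → Carrier → Set) → (Carrier → Carrier) → Carrier → Set
  Ker _≈_ μ x = μ x ≈ 𝟏

  IsDS : (Carrier → Set) → Set
  IsDS D = D 𝟏 × (∀ x y → D x → D (x ⇒ y) → D y)

  IsNormalDS : (Carrier → Set) → Set
  IsNormalDS D = IsDS D × (∀ x y → (D (x ⇒ y) → D (x ⇝ y)) × (D (x ⇝ y) → D (x ⇒ y)))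

  NormalTypeI : (Carrier → Carrier → Set) → (Carrier → Carrier) → Set
  NormalTypeI _≈_ μ = TypeI _≈_ μ × IsNormalDS (Ker _≈_ μ)

  NormalTypeII : (Carrier → Carrier → Set) → (Carrier → Carrier) → Set
  NormalTypeII _≈_ μ = TypeII _≈_ μ × IsNormalDS (Ker _≈_ μ)

  Θ : (Carrier → Set) → Carrier → Carrier → Set
  Θ H x y = H (x ⇒ y) × H (y ⇒ x)

-- A type II state operator is already of type I: applying (IS2') to
-- (x → y) ⇝ y gives μ((x → y) ⇝ y) = μ(x → y) ⇝ μ y, because y ≤ x → y; with
-- the identity ((p → q) ⇝ q) → q = p → q this turns (IS2') into (IS2).
-- In A/Ker(μ) every equation of A holds, a/K = 1/K iff μ a = 1, and (IS3)
-- makes μ idempotent, so Ker(μ̂) corresponds to Ker(μ) and μ̂ inherits every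
-- axiom from μ; monotonicity of μ̂ is μ(x → y) = 1 ⇒ μ x ≤ μ y, from (IS1)+(IS2).
module Submission where

open import Defs
open import Data.Product using (_×_; _,_; proj₁; proj₂; map)
open import Relation.Binary.PropositionalEquality
  using (_≡_; refl; sym; trans; cong; subst; subst₂)
open import Relation.Unary using (_≐_)
open Relation.Binary.PropositionalEquality.≡-Reasoning

module PseudoBCKProperties (A : PseudoBCK) where
  open PseudoBCK A

  _≤_ : Carrier → Carrier → Set
  x ≤ y = Leq A _≡_ x y

  mp-⇒ : ∀ {a b} → a ≡ 𝟏 → a ⇒ b ≡ 𝟏 → b ≡ 𝟏
  mp-⇒ {a} {b} a≡𝟏 a⇒b≡𝟏 = trans (sym (ax3 b)) (trans (cong (_⇒ b) (sym a≡𝟏)) a⇒b≡𝟏)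

  mp-⇝ : ∀ {a b} → a ≡ 𝟏 → a ⇝ b ≡ 𝟏 → b ≡ 𝟏
  mp-⇝ {a} {b} a≡𝟏 a⇝b≡𝟏 = trans (sym (ax4 b)) (trans (cong (_⇝ b) (sym a≡𝟏)) a⇝b≡𝟏)

  ⇝-refl : ∀ z → z ⇝ z ≡ 𝟏
  ⇝-refl z = begin
    z ⇝ z                         ≡⟨ sym (ax4 _) ⟩
    𝟏 ⇝ (z ⇝ z)                   ≡⟨ cong (λ w → w ⇝ (z ⇝ z)) (sym (ax5 𝟏)) ⟩
    (𝟏 ⇒ 𝟏) ⇝ (z ⇝ z)             ≡⟨ cong (λ w → (𝟏 ⇒ 𝟏) ⇝ (w ⇝ w)) (sym (ax3 z)) ⟩
    (𝟏 ⇒ 𝟏) ⇝ ((𝟏 ⇒ z) ⇝ (𝟏 ⇒ z)) ≡⟨ ax1 𝟏 𝟏 z ⟩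
    𝟏                             ∎

  ⇒-refl : ∀ z → z ⇒ z ≡ 𝟏
  ⇒-refl z = ord⇝⇒ z z (⇝-refl z)

  ≤-trans : ∀ {x y z} → x ≤ y → y ≤ z → x ≤ z
  ≤-trans {x} {y} {z} x≤y y≤z = mp-⇝ y≤z (mp-⇝ x≤y (ax1 x y z))

  ⇒-antitoneˡ : ∀ {x y} z → x ≤ y → (y ⇒ z) ≤ (x ⇒ z)
  ⇒-antitoneˡ {x} {y} z x≤y = ord⇝⇒ _ _ (mp-⇝ x≤y (ax1 x y z))

  ⇝-antitoneˡ : ∀ {x y} z → x ≤ y → (y ⇝ z) ≤ (x ⇝ z)
  ⇝-antitoneˡ {x} {y} z x≤y = mp-⇒ (ord⇒⇝ x y x≤y) (ax2 x y z)

  x≤[x⇒y]⇝y : ∀ x y → x ≤ ((x ⇒ y) ⇝ y)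
  x≤[x⇒y]⇝y x y =
    ord⇝⇒ _ _ (subst₂ (λ a b → a ⇝ ((x ⇒ y) ⇝ b) ≡ 𝟏) (ax3 x) (ax3 y) (ax1 𝟏 x y))

  x≤[x⇝y]⇒y : ∀ x y → x ≤ ((x ⇝ y) ⇒ y)
  x≤[x⇝y]⇒y x y = subst₂ (λ a b → a ⇒ ((x ⇝ y) ⇒ b) ≡ 𝟏) (ax4 x) (ax4 y) (ax2 𝟏 x y)

  y≤x⇒y : ∀ x y → y ≤ (x ⇒ y)
  y≤x⇒y x y = subst (λ a → a ⇒ (x ⇒ y) ≡ 𝟏) (ax3 y) (⇒-antitoneˡ y (ax5 x))

  y≤x⇝y : ∀ x y → y ≤ (x ⇝ y)
  y≤x⇝y x y = subst (λ a → a ⇒ (x ⇝ y) ≡ 𝟏) (ax4 y) (⇝-antitoneˡ y (ax5 x))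

  [[x⇒y]⇝y]⇒y≡x⇒y : ∀ x y → ((x ⇒ y) ⇝ y) ⇒ y ≡ x ⇒ y
  [[x⇒y]⇝y]⇒y≡x⇒y x y = ax6 _ _ (⇒-antitoneˡ y (x≤[x⇒y]⇝y x y)) (x≤[x⇝y]⇒y (x ⇒ y) y)

  [[x⇝y]⇒y]⇝y≡x⇝y : ∀ x y → ((x ⇝ y) ⇒ y) ⇝ y ≡ x ⇝ y
  [[x⇝y]⇒y]⇝y≡x⇝y x y = ax6 _ _ (⇝-antitoneˡ y (x≤[x⇝y]⇒y x y)) (x≤[x⇒y]⇝y (x ⇝ y) y)

module CongruenceProperties (A : PseudoBCK) (H : PseudoBCK.Carrier A → Set) where
  open PseudoBCK A
  open PseudoBCKProperties A

  ≡⇒Θ : H 𝟏 → ∀ {x y} → x ≡ y → Θ A H x y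
  ≡⇒Θ H𝟏 {x} refl = subst H (sym (⇒-refl x)) H𝟏 , subst H (sym (⇒-refl x)) H𝟏

  ∈H⇒Θ𝟏 : H 𝟏 → ∀ {x} → H x → Θ A H x 𝟏
  ∈H⇒Θ𝟏 H𝟏 {x} x∈H = subst H (sym (ax5 x)) H𝟏 , subst H (sym (ax3 x)) x∈H

  Θ𝟏⇒∈H : ∀ {x} → Θ A H x 𝟏 → H x
  Θ𝟏⇒∈H {x} (_ , 𝟏⇒x∈H) = subst H (ax3 x) 𝟏⇒x∈H

module _ (A : PseudoBCK) where
  open PseudoBCK A

  IsNormalDS-resp-≐ : ∀ {P Q : Carrier → Set} → P ≐ Q → IsNormalDS A P → IsNormalDS A Q
  IsNormalDS-resp-≐ (P⊆Q , Q⊆P) ((P𝟏 , mp) , normal) =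
    (P⊆Q P𝟏 , λ x y x∈Q x⇒y∈Q → P⊆Q (mp x y (Q⊆P x∈Q) (Q⊆P x⇒y∈Q))) ,
    λ x y → (λ q → P⊆Q (proj₁ (normal x y) (Q⊆P q))) ,
            (λ q → P⊆Q (proj₂ (normal x y) (Q⊆P q)))

module StateOperatorProperties (A : PseudoBCK) (μ : PseudoBCK.Carrier A → PseudoBCK.Carrier A) where
  open PseudoBCK A
  open PseudoBCKProperties A

  IS3⇒μ𝟏≡𝟏 : IS3 A _≡_ μ → μ 𝟏 ≡ 𝟏
  IS3⇒μ𝟏≡𝟏 is3 = begin
    μ 𝟏             ≡⟨ cong μ (sym (⇒-refl (μ 𝟏))) ⟩
    μ (μ 𝟏 ⇒ μ 𝟏)   ≡⟨ proj₁ (is3 𝟏 𝟏) ⟩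
    μ 𝟏 ⇒ μ 𝟏       ≡⟨ ⇒-refl (μ 𝟏) ⟩
    𝟏               ∎

  IS3⇒idempotent : IS3 A _≡_ μ → ∀ x → μ (μ x) ≡ μ x
  IS3⇒idempotent is3 x = begin
    μ (μ x)         ≡⟨ cong μ (sym (ax3 (μ x))) ⟩
    μ (𝟏 ⇒ μ x)     ≡⟨ cong (λ w → μ (w ⇒ μ x)) (sym (IS3⇒μ𝟏≡𝟏 is3)) ⟩
    μ (μ 𝟏 ⇒ μ x)   ≡⟨ proj₁ (is3 𝟏 x) ⟩
    μ 𝟏 ⇒ μ x       ≡⟨ cong (_⇒ μ x) (IS3⇒μ𝟏≡𝟏 is3) ⟩
    𝟏 ⇒ μ x         ≡⟨ ax3 _ ⟩
    μ x             ∎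

  IS2'⇒IS2 : IS2' A _≡_ μ → IS2 A _≡_ μ
  IS2'⇒IS2 is2' x y = μ[x⇒y] , μ[x⇝y]
    where
    μ[[x⇒y]⇝y] : μ ((x ⇒ y) ⇝ y) ≡ μ (x ⇒ y) ⇝ μ y
    μ[[x⇒y]⇝y] = begin
      μ ((x ⇒ y) ⇝ y)                    ≡⟨ proj₂ (is2' (x ⇒ y) y) ⟩
      μ ((y ⇝ (x ⇒ y)) ⇒ (x ⇒ y)) ⇝ μ y  ≡⟨ cong (λ w → μ (w ⇒ (x ⇒ y)) ⇝ μ y) (ord⇒⇝ _ _ (y≤x⇒y x y)) ⟩
      μ (𝟏 ⇒ (x ⇒ y)) ⇝ μ y              ≡⟨ cong (λ w → μ w ⇝ μ y) (ax3 _) ⟩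
      μ (x ⇒ y) ⇝ μ y                    ∎

    μ[[x⇝y]⇒y] : μ ((x ⇝ y) ⇒ y) ≡ μ (x ⇝ y) ⇒ μ y
    μ[[x⇝y]⇒y] = begin
      μ ((x ⇝ y) ⇒ y)                    ≡⟨ proj₁ (is2' (x ⇝ y) y) ⟩
      μ ((y ⇒ (x ⇝ y)) ⇝ (x ⇝ y)) ⇒ μ y  ≡⟨ cong (λ w → μ (w ⇝ (x ⇝ y)) ⇒ μ y) (y≤x⇝y x y) ⟩
      μ (𝟏 ⇝ (x ⇝ y)) ⇒ μ y              ≡⟨ cong (λ w → μ w ⇒ μ y) (ax4 _) ⟩
      μ (x ⇝ y) ⇒ μ y                    ∎

    μ[x⇒y] : μ (x ⇒ y) ≡ μ ((x ⇒ y) ⇝ y) ⇒ μ y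
    μ[x⇒y] = begin
      μ (x ⇒ y)                  ≡⟨ proj₁ (is2' x y) ⟩
      b ⇒ μ y                    ≡⟨ sym ([[x⇒y]⇝y]⇒y≡x⇒y b (μ y)) ⟩
      ((b ⇒ μ y) ⇝ μ y) ⇒ μ y    ≡⟨ cong (λ w → (w ⇝ μ y) ⇒ μ y) (sym (proj₁ (is2' x y))) ⟩
      (μ (x ⇒ y) ⇝ μ y) ⇒ μ y    ≡⟨ cong (_⇒ μ y) (sym μ[[x⇒y]⇝y]) ⟩
      μ ((x ⇒ y) ⇝ y) ⇒ μ y      ∎
      where b = μ ((y ⇒ x) ⇝ x)

    μ[x⇝y] : μ (x ⇝ y) ≡ μ ((x ⇝ y) ⇒ y) ⇝ μ y
    μ[x⇝y] = begin
      μ (x ⇝ y)                  ≡⟨ proj₂ (is2' x y) ⟩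
      b ⇝ μ y                    ≡⟨ sym ([[x⇝y]⇒y]⇝y≡x⇝y b (μ y)) ⟩
      ((b ⇝ μ y) ⇒ μ y) ⇝ μ y    ≡⟨ cong (λ w → (w ⇒ μ y) ⇝ μ y) (sym (proj₂ (is2' x y))) ⟩
      (μ (x ⇝ y) ⇒ μ y) ⇝ μ y    ≡⟨ cong (_⇝ μ y) (sym μ[[x⇝y]⇒y]) ⟩
      μ ((x ⇝ y) ⇒ y) ⇝ μ y      ∎
      where b = μ ((y ⇝ x) ⇒ x)

  μ[x⇒y]≡𝟏⇒μx≤μy : IS1 A _≡_ μ → IS2 A _≡_ μ → ∀ x y → μ (x ⇒ y) ≡ 𝟏 → μ x ≤ μ y
  μ[x⇒y]≡𝟏⇒μx≤μy is1 is2 x y μ[x⇒y]≡𝟏 =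
    ≤-trans (is1 x ((x ⇒ y) ⇝ y) (x≤[x⇒y]⇝y x y)) (trans (sym (proj₁ (is2 x y))) μ[x⇒y]≡𝟏)

module KernelQuotient (A : PseudoBCK) (μ : PseudoBCK.Carrier A → PseudoBCK.Carrier A)
                      (is1 : IS1 A _≡_ μ) (is2 : IS2 A _≡_ μ) (is3 : IS3 A _≡_ μ) where
  open PseudoBCK A
  open StateOperatorProperties A μ

  K : Carrier → Set
  K = Ker A _≡_ μ

  open CongruenceProperties A K

  K𝟏 : K 𝟏
  K𝟏 = IS3⇒μ𝟏≡𝟏 is3

  K-μ-⇒ : ∀ x y → K (x ⇒ y) → K (μ x ⇒ μ y)
  K-μ-⇒ x y x⇒y∈K = trans (proj₁ (is3 x y)) (μ[x⇒y]≡𝟏⇒μx≤μy is1 is2 x y x⇒y∈K)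

  μ-resp-Θ : ∀ x y → Θ A K x y → Θ A K (μ x) (μ y)
  μ-resp-Θ x y (x⇒y∈K , y⇒x∈K) = K-μ-⇒ x y x⇒y∈K , K-μ-⇒ y x y⇒x∈K

  IS1-Θ : IS1 A (Θ A K) μ
  IS1-Θ x y x≤y = ∈H⇒Θ𝟏 K𝟏 (K-μ-⇒ x y (Θ𝟏⇒∈H x≤y))

  K≐Ker-Θ : K ≐ Ker A (Θ A K) μ
  K≐Ker-Θ = (λ {x} x∈K → ∈H⇒Θ𝟏 K𝟏 (trans (IS3⇒idempotent is3 x) x∈K))
          , (λ {x} μx∈K → trans (sym (IS3⇒idempotent is3 x)) (Θ𝟏⇒∈H μx∈K))

proposition5p14 : (A : PseudoBCK) (μ : PseudoBCK.Carrier A → PseudoBCK.Carrier A) →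
    NormalTypeII A _≡_ μ →
    ( ( ∀ x y → Θ A (Ker A _≡_ μ) x y → Θ A (Ker A _≡_ μ) (μ x) (μ y) )
    × NormalTypeI A (Θ A (Ker A _≡_ μ)) μ
    × NormalTypeII A (Θ A (Ker A _≡_ μ)) μ )
    × NormalTypeI A _≡_ μ
proposition5p14 A μ ((is1 , is2' , is3) , K-normal) =
  (μ-resp-Θ , ((IS1-Θ , IS2-Θ , IS3-Θ) , Ker-Θ-normal) , ((IS1-Θ , IS2'-Θ , IS3-Θ) , Ker-Θ-normal)) ,
  ((is1 , is2 , is3) , K-normal)
  where
  open StateOperatorProperties A μ using (IS2'⇒IS2)
  is2 : IS2 A _≡_ μ
  is2 = IS2'⇒IS2 is2'
  open KernelQuotient A μ is1 is2 is3
  open CongruenceProperties A K using (≡⇒Θ)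

  IS2-Θ : IS2 A (Θ A K) μ
  IS2-Θ x y = map (≡⇒Θ K𝟏) (≡⇒Θ K𝟏) (is2 x y)

  IS2'-Θ : IS2' A (Θ A K) μ
  IS2'-Θ x y = map (≡⇒Θ K𝟏) (≡⇒Θ K𝟏) (is2' x y)

  IS3-Θ : IS3 A (Θ A K) μ
  IS3-Θ x y = map (≡⇒Θ K𝟏) (≡⇒Θ K𝟏) (is3 x y)

  Ker-Θ-normal : IsNormalDS A (Ker A (Θ A K) μ)
  Ker-Θ-normal = IsNormalDS-resp-≐ A K≐Ker-Θ K-normal
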